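{- Let $\ell>0$ and $b\neq0$ be integers with $\ell^2+4b\geq0$, let $\mathbf{s}$ be defined by $s_0=0$, $s_1=1$, $s_j=\ell s_{j-1}+bs_{j-2}$ for $j\geq2$, and let $r=\gcd(\ell,b)$, $t=\gcd(\ell^2/r,\,b/r)$, $\sigma=r/t$. Then for every $n\geq1$, $\gcd(s_{n+1},s_n)$ divides $t^n\sigma^{\lfloor n/2\rfloor}$. -}

module Defs where

open import Data.Nat using (ℕ; zero; suc; _/_)
open import Data.Integer using (ℤ; +_; _+_; _*_)

s : ℤ → ℤ → ℕ → ℤ
s ℓ b zero = + 0
s ℓ b (suc zero) = + 1
s ℓ b (suc (suc j)) = ℓ * s ℓ b (suc j) + b * s ℓ b j

-- Natural-number division, totalised by m ÷ 0 = 0.  It is only ever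
-- applied with a nonzero divisor that exactly divides the dividend.
_÷_ : ℕ → ℕ → ℕ
m ÷ zero = 0
m ÷ suc k = m / suc k

-- NatFacts: r, t, σ factorise the parameters, |ℓ| = t σ L and |b| = t² σ B
-- with gcd (σ L, B) = 1 (factorisation); the key point is that t divides r.
-- LucasSequence: scaling the parameters (p, q) to (t p, t² q) multiplies
-- s_{n+1} by t^n (s-scale), so it remains to treat p = σ L, q = σ B.  There
-- the terms of index 2k + 1 are σ^k U_k with U_k coprime to q (Cofactors).
-- The gcd G n of s_{n+1} and s_n contains the odd-indexed term s_{2⌊n/2⌋+1},
-- and G (n+1) divides |q| G n by the recurrence; by induction G (n+1) divides
-- both q σ^k and U_k σ^k for k = ⌊(n+1)/2⌋, hence σ^k (G-bound).
module Submission where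

open import Defs

module NatFacts where

  open import Data.Nat.Base
    using (ℕ; zero; suc; _*_; _^_; _/_; _≤_; z≤n; s≤s; ⌊_/2⌋; NonZero; ≢-nonZero; ≢-nonZero⁻¹)
  open import Data.Nat.Properties
    using (*-assoc; *-comm; *-zeroʳ; m*n≢0)
  open import Data.Nat.Divisibility
    using (_∣_; ∣-refl; ∣-trans; 1∣_; 0∣⇒≡0; ∣m⇒∣m*n; *-monoʳ-∣; *-monoˡ-∣)
  open import Data.Nat.DivMod using (m*[n/m]≡n; m*n/n≡m; /-congˡ; +-distrib-/-∣ˡ)
  open import Data.Nat.GCD
    using (gcd; gcd[m,n]∣m; gcd[m,n]∣n; gcd-greatest; gcd[m,n]≢0; c*gcd[m,n]≡gcd[cm,cn])
  open import Data.Nat.Coprimality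
    using (Coprime; coprime-/gcd; coprime-divisor) renaming (sym to coprime-sym)
  open import Data.Nat.Tactic.RingSolver using (solve-∀)
  open import Data.Product using (∃₂; _×_; _,_)
  open import Data.Sum using (_⊎_; inj₁; inj₂)
  open import Relation.Binary.PropositionalEquality
    using (_≡_; refl; sym; trans; cong; cong₂; subst; subst₂; module ≡-Reasoning)

  ^-monoʳ-∣ : ∀ m {a b} → a ≤ b → m ^ a ∣ m ^ b
  ^-monoʳ-∣ m {b = b} z≤n = 1∣ (m ^ b)
  ^-monoʳ-∣ m (s≤s a≤b) = *-monoʳ-∣ m (^-monoʳ-∣ m a≤b)

  ⌊n/2⌋≡n/2 : ∀ n → ⌊ n /2⌋ ≡ n / 2
  ⌊n/2⌋≡n/2 zero = refl
  ⌊n/2⌋≡n/2 (suc zero) = refl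
  ⌊n/2⌋≡n/2 (suc (suc n)) =
    trans (cong suc (⌊n/2⌋≡n/2 n)) (sym (+-distrib-/-∣ˡ {2} n {2} ∣-refl))

  -- 2k, by recursion, so that double (k + 1) unfolds to double k + 2.
  double : ℕ → ℕ
  double zero = zero
  double (suc k) = suc (suc (double k))

  parity : ∀ n → n ≡ double ⌊ n /2⌋ ⊎ n ≡ suc (double ⌊ n /2⌋)
  parity zero = inj₁ refl
  parity (suc zero) = inj₂ refl
  parity (suc (suc n)) with parity n
  ... | inj₁ e = inj₁ (cong (λ j → suc (suc j)) e)
  ... | inj₂ e = inj₂ (cong (λ j → suc (suc j)) e)

  -- Of two consecutive terms f (n+1), f n one has index 2⌊n/2⌋ + 1, so the
  -- gcd of consecutive terms divides that odd-indexed term.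
  gcd-consecutive-∣-odd : ∀ (f : ℕ → ℕ) n → gcd (f (suc n)) (f n) ∣ f (suc (double ⌊ n /2⌋))
  gcd-consecutive-∣-odd f n with parity n
  ... | inj₁ e = subst (λ j → gcd (f (suc n)) (f n) ∣ f (suc j)) e (gcd[m,n]∣m (f (suc n)) (f n))
  ... | inj₂ e = subst (λ j → gcd (f (suc n)) (f n) ∣ f j) e (gcd[m,n]∣n (f (suc n)) (f n))

  gcd-scaled-∣ : ∀ c d x y → d ∣ c → gcd (c * x) (d * y) ∣ c * gcd x y
  gcd-scaled-∣ c d x y d∣c =
    subst (gcd (c * x) (d * y) ∣_) (sym (c*gcd[m,n]≡gcd[cm,cn] c x y))
      (gcd-greatest (gcd[m,n]∣m (c * x) (d * y))
                    (∣-trans (gcd[m,n]∣n (c * x) (d * y)) (*-monoˡ-∣ y d∣c)))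

  coprime-∣ˡ : ∀ {d m n} → d ∣ m → Coprime m n → Coprime d n
  coprime-∣ˡ d∣m m⊥n (i∣d , i∣n) = m⊥n (∣-trans i∣d d∣m , i∣n)

  coprime-*ˡ : ∀ {m o n} → Coprime m n → Coprime o n → Coprime (m * o) n
  coprime-*ˡ {m} {o} {n} m⊥n o⊥n {i} (i∣mo , i∣n) = o⊥n (i∣o , i∣n)
    where
    i⊥m : Coprime i m
    i⊥m (j∣i , j∣m) = m⊥n (j∣m , ∣-trans j∣i i∣n)
    i∣o : i ∣ o
    i∣o = coprime-divisor i⊥m i∣mo

  -- Exact division by the total quotient _÷_ (also when k = 0, as then m = 0).
  ÷-exact : ∀ {k m} → k ∣ m → m ≡ k * (m ÷ k)
  ÷-exact {zero} 0∣m = 0∣⇒≡0 0∣m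
  ÷-exact {suc k} k∣m = sym (m*[n/m]≡n k∣m)

  ÷-cancel : ∀ k m → .{{NonZero k}} → (k * m) ÷ k ≡ m
  ÷-cancel (suc k) m = trans (/-congˡ (*-comm (suc k) m)) (m*n/n≡m m (suc k))

  coprime-÷gcd : ∀ m n → .{{NonZero (gcd m n)}} → Coprime (m ÷ gcd m n) (n ÷ gcd m n)
  coprime-÷gcd m n = subst₂ Coprime (÷≡/ m) (÷≡/ n) (coprime-/gcd m n)
    where
    ÷≡/ : ∀ x → x / gcd m n ≡ x ÷ gcd m n
    ÷≡/ x with gcd m n
    ... | suc _ = refl

  -- The key observation: if gcd (L, B) = 1 then t = gcd (r L², B) divides r,
  -- because t divides B and is therefore coprime to L².
  reduced-gcd-∣ : ∀ r L B t → Coprime L B → t ≡ gcd (r * (L * L)) B → t ∣ r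
  reduced-gcd-∣ r L B t L⊥B refl =
    coprime-divisor t⊥LL (subst (t ∣_) (*-comm r (L * L)) (gcd[m,n]∣m (r * (L * L)) B))
    where
    t⊥LL : Coprime t (L * L)
    t⊥LL = coprime-∣ˡ (gcd[m,n]∣n (r * (L * L)) B) (coprime-sym (coprime-*ˡ L⊥B L⊥B))

  -- Removing t from r and from B: the parts σ = r / t and B / t satisfy
  -- gcd (σ L, B / t) = 1, since gcd (σ L², B / t) = gcd (r L², B) / t = 1.
  reduced-coprime : ∀ r L B t → .{{NonZero r}} → .{{NonZero L}} →
                    Coprime L B → t ≡ gcd (r * (L * L)) B → Coprime ((r ÷ t) * L) (B ÷ t)
  reduced-coprime r L B t L⊥B t≡gcd@refl =
    coprime-∣ˡ σL∣σLL (subst (λ x → Coprime x (B ÷ t)) rLL÷t≡σLL (coprime-÷gcd (r * (L * L)) B))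
    where
    instance
      LL≢0 : NonZero (L * L)
      LL≢0 = m*n≢0 L L
      rLL≢0 : NonZero (r * (L * L))
      rLL≢0 = m*n≢0 r (L * L)
      t≢0 : NonZero t
      t≢0 = ≢-nonZero (gcd[m,n]≢0 (r * (L * L)) B (inj₁ (≢-nonZero⁻¹ (r * (L * L)))))
    σ : ℕ
    σ = r ÷ t
    rLL÷t≡σLL : (r * (L * L)) ÷ t ≡ σ * (L * L)
    rLL÷t≡σLL = begin
      (r * (L * L)) ÷ t         ≡⟨ cong (λ x → (x * (L * L)) ÷ t) (÷-exact (reduced-gcd-∣ r L B t L⊥B t≡gcd)) ⟩
      ((t * σ) * (L * L)) ÷ t   ≡⟨ cong (_÷ t) (*-assoc t σ (L * L)) ⟩
      (t * (σ * (L * L))) ÷ t   ≡⟨ ÷-cancel t (σ * (L * L)) ⟩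
      σ * (L * L)               ∎
      where open ≡-Reasoning
    σL∣σLL : σ * L ∣ σ * (L * L)
    σL∣σLL = subst (σ * L ∣_) (*-assoc σ L L) (∣m⇒∣m*n L ∣-refl)

  factorisation : ∀ l c → .{{NonZero l}} →
    let r = gcd l c
        t = gcd ((l ^ 2) ÷ r) (c ÷ r)
        σ = r ÷ t
    in ∃₂ λ L B → l ≡ t * (σ * L) × c ≡ t * (t * (σ * B)) × Coprime (σ * L) B
  factorisation l c = L , (c ÷ r) ÷ t , l≡tσL , c≡ttσB′ , reduced-coprime r L B t L⊥B t≡gcd
    where
    r L B t σ : ℕ
    r = gcd l c
    L = l ÷ r
    B = c ÷ r
    t = gcd ((l ^ 2) ÷ r) (c ÷ r)
    σ = r ÷ t
    instance
      r≢0 : NonZero r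
      r≢0 = ≢-nonZero (gcd[m,n]≢0 l c (inj₁ (≢-nonZero⁻¹ l)))
    l≡rL : l ≡ r * L
    l≡rL = ÷-exact (gcd[m,n]∣m l c)
    c≡rB : c ≡ r * B
    c≡rB = ÷-exact (gcd[m,n]∣n l c)
    instance
      L≢0 : NonZero L
      L≢0 = ≢-nonZero λ L≡0 → ≢-nonZero⁻¹ l (trans l≡rL (trans (cong (r *_) L≡0) (*-zeroʳ r)))
    L⊥B : Coprime L B
    L⊥B = coprime-÷gcd l c
    square : ∀ r L → (r * L) * ((r * L) * 1) ≡ r * (r * (L * L))
    square = solve-∀
    t≡gcd : t ≡ gcd (r * (L * L)) B
    t≡gcd = cong (λ x → gcd x B) (trans (cong (λ x → (x ^ 2) ÷ r) l≡rL)
                                       (trans (cong (_÷ r) (square r L)) (÷-cancel r (r * (L * L)))))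
    r≡tσ : r ≡ t * σ
    r≡tσ = ÷-exact (reduced-gcd-∣ r L B t L⊥B t≡gcd)
    B≡tB′ : B ≡ t * (B ÷ t)
    B≡tB′ = ÷-exact (subst (_∣ B) (sym t≡gcd) (gcd[m,n]∣n (r * (L * L)) B))
    l≡tσL : l ≡ t * (σ * L)
    l≡tσL = trans l≡rL (trans (cong (_* L) r≡tσ) (*-assoc t σ L))
    regroup : ∀ t σ B′ → (t * σ) * (t * B′) ≡ t * (t * (σ * B′))
    regroup = solve-∀
    c≡ttσB′ : c ≡ t * (t * (σ * ((c ÷ r) ÷ t)))
    c≡ttσB′ = trans c≡rB (trans (cong₂ _*_ r≡tσ B≡tB′) (regroup t σ (B ÷ t)))

module LucasSequence where

  open import Data.Nat.Base as ℕ using (ℕ; zero; suc; _^_; ⌊_/2⌋)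
  open import Data.Nat.Properties using (*-comm; ⌊n/2⌋-mono; n≤1+n)
  open import Data.Nat.Divisibility as ℕᵈ using (∣-trans; *-monoʳ-∣; ∣n⇒∣m*n)
  open import Data.Nat.GCD using (gcd; gcd[m,n]∣m; gcd[m,n]∣n; gcd-greatest; c*gcd[m,n]≡gcd[cm,cn])
  open import Data.Nat.Coprimality as ℕᶜ using (1-coprimeTo; coprime-factors)
  open import Data.Integer.Base using (ℤ; +_; _+_; _*_; ∣_∣)
  open import Data.Integer.Properties using (abs-*; pos-*)
  import Data.Integer.Divisibility.Signed as ℤˢ
  open import Data.Integer.Coprimality using (Coprime)
  open import Data.Integer.Tactic.RingSolver using (solve-∀)
  open import Data.Product using (_,_; _×_; proj₁; proj₂)
  open import Relation.Binary.PropositionalEquality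
    using (_≡_; refl; sym; trans; cong; cong₂; subst; module ≡-Reasoning)
  open NatFacts using (^-monoʳ-∣; double; gcd-consecutive-∣-odd; coprime-∣ˡ)

  Scales : ℕ → ℤ → ℤ → ℕ → Set
  Scales c p q n = s (+ c * p) (+ c * (+ c * q)) (suc n) ≡ + (c ^ n) * s p q (suc n)

  scale-step : ∀ c p q n → Scales c p q n → Scales c p q (suc n) → Scales c p q (suc (suc n))
  scale-step c p q n scalesₙ scalesₙ₊₁ = begin
    C * p * s′ (suc (suc n)) + C * (C * q) * s′ (suc n)
      ≡⟨ cong₂ (λ x y → C * p * x + C * (C * q) * y) scalesₙ₊₁′ scalesₙ ⟩
    C * p * ((C * P) * S (suc (suc n))) + C * (C * q) * (P * S (suc n))
      ≡⟨ two-steps C p q P (S (suc (suc n))) (S (suc n)) ⟩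
    (C * (C * P)) * S (suc (suc (suc n)))
      ≡⟨ cong (_* S (suc (suc (suc n)))) (sym (trans (pos-* c _) (cong (C *_) (pos-* c _)))) ⟩
    + (c ^ suc (suc n)) * S (suc (suc (suc n)))  ∎
    where
    open ≡-Reasoning
    C P : ℤ
    C = + c
    P = + (c ^ n)
    S s′ : ℕ → ℤ
    S = s p q
    s′ = s (C * p) (C * (C * q))
    scalesₙ₊₁′ : s′ (suc (suc n)) ≡ (C * P) * S (suc (suc n))
    scalesₙ₊₁′ = trans scalesₙ₊₁ (cong (_* S (suc (suc n))) (pos-* c (c ^ n)))
    two-steps : ∀ C p q P x y →
                C * p * ((C * P) * x) + C * (C * q) * (P * y) ≡ (C * (C * P)) * (p * x + q * y)
    two-steps = solve-∀

  s-scale : ∀ c p q n → Scales c p q n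
  s-scale c p q zero = refl
  s-scale c p q (suc zero) = trans (first-step (+ c) p q) (cong (_* s p q 2) (sym (pos-* c 1)))
    where
    first-step : ∀ C p q → C * p * + 1 + C * (C * q) * + 0 ≡ (C * + 1) * (p * + 1 + q * + 0)
    first-step = solve-∀
  s-scale c p q (suc (suc n)) = scale-step c p q n (s-scale c p q n) (s-scale c p q (suc n))

  G : ℤ → ℤ → ℕ → ℕ
  G p q n = gcd ∣ s p q (suc n) ∣ ∣ s p q n ∣

  -- By the recurrence, a common divisor of s_{n+2}, s_{n+1} divides q s_n,
  -- so G (n+1) divides |q| G n.
  G-step : ∀ p q n → G p q (suc n) ℕᵈ.∣ ∣ q ∣ ℕ.* G p q n
  G-step p q n =
    subst (d ℕᵈ.∣_) (sym (c*gcd[m,n]≡gcd[cm,cn] (∣ q ∣) (∣ S (suc n) ∣) (∣ S n ∣)))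
      (gcd-greatest (∣n⇒∣m*n ∣ q ∣ d∣Sₙ₊₁) (subst (d ℕᵈ.∣_) (abs-* q (S n)) d∣qSₙ))
    where
    S : ℕ → ℤ
    S = s p q
    d : ℕ
    d = G p q (suc n)
    d∣Sₙ₊₂ : d ℕᵈ.∣ ∣ S (suc (suc n)) ∣
    d∣Sₙ₊₂ = gcd[m,n]∣m (∣ S (suc (suc n)) ∣) (∣ S (suc n) ∣)
    d∣Sₙ₊₁ : d ℕᵈ.∣ ∣ S (suc n) ∣
    d∣Sₙ₊₁ = gcd[m,n]∣n (∣ S (suc (suc n)) ∣) (∣ S (suc n) ∣)
    d∣qSₙ : d ℕᵈ.∣ ∣ q * S n ∣
    d∣qSₙ = ℤˢ.∣⇒∣ᵤ (ℤˢ.∣m+n∣m⇒∣n (ℤˢ.∣ᵤ⇒∣ {+ d} {S (suc (suc n))} d∣Sₙ₊₂)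
                                (ℤˢ.∣n⇒∣m*n p (ℤˢ.∣ᵤ⇒∣ {+ d} {S (suc n)} d∣Sₙ₊₁)))

  coprime-*ˡ : ∀ a b m → Coprime a m → Coprime b m → Coprime (a * b) m
  coprime-*ˡ a b m a⊥m b⊥m =
    subst (λ x → ℕᶜ.Coprime x ∣ m ∣) (sym (abs-* a b)) (NatFacts.coprime-*ˡ a⊥m b⊥m)

  coprime-*ʳ : ∀ a m n → Coprime a m → Coprime a n → Coprime a (m * n)
  coprime-*ʳ a m n a⊥m a⊥n = ℕᶜ.sym (coprime-*ˡ m n a (ℕᶜ.sym a⊥m) (ℕᶜ.sym a⊥n))

  factor-coprimeˡ : ∀ a b m → Coprime (a * b) m → Coprime a m
  factor-coprimeˡ a b m =
    coprime-∣ˡ (subst (∣ a ∣ ℕᵈ.∣_) (sym (abs-* a b)) (ℕᵈ.∣m⇒∣m*n ∣ b ∣ ℕᵈ.∣-refl))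

  factor-coprimeʳ : ∀ a b m → Coprime (a * b) m → Coprime b m
  factor-coprimeʳ a b m =
    coprime-∣ˡ (subst (∣ b ∣ ℕᵈ.∣_) (sym (abs-* a b)) (ℕᵈ.∣n⇒∣m*n ∣ a ∣ ℕᵈ.∣-refl))

  coprime-+-multiple : ∀ a m c → Coprime a m → Coprime (a + m * c) m
  coprime-+-multiple a m c a⊥m {i} (i∣a+mc , i∣m) = a⊥m (i∣a , i∣m)
    where
    i∣a : i ℕᵈ.∣ ∣ a ∣
    i∣a = ℤˢ.∣⇒∣ᵤ {+ i} {a} (ℤˢ.∣m+n∣n⇒∣m (ℤˢ.∣ᵤ⇒∣ {+ i} {a + m * c} i∣a+mc)
                                        (ℤˢ.∣m⇒∣m*n c (ℤˢ.∣ᵤ⇒∣ {+ i} {m} i∣m)))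

  module Cofactors (σ : ℕ) (L B : ℤ) where

    p q : ℤ
    p = + σ * L
    q = + σ * B

    S : ℕ → ℤ
    S = s p q

    -- The recurrence with the common power of σ divided out: V k and U k stand
    -- for S_{2k} / σ^k and S_{2k+1} / σ^k.
    V U : ℕ → ℤ
    V zero = + 0
    V (suc k) = L * U k + B * V k
    U zero = + 1
    U (suc k) = + σ * L * V (suc k) + B * U k

    -- Two steps of the recurrence raise the power of σ by one.
    cofactors : ∀ k → S (double k) ≡ + (σ ^ k) * V k × S (suc (double k)) ≡ + (σ ^ k) * U k
    cofactors zero = refl , refl
    cofactors (suc k) = even , odd
      where
      Σ : ℤ
      Σ = + (σ ^ k)
      even-identity : ∀ σ L B Σ u v → σ * L * (Σ * u) + σ * B * (Σ * v) ≡ (σ * Σ) * (L * u + B * v)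
      even-identity = solve-∀
      odd-identity : ∀ σ L B Σ u v → σ * L * ((σ * Σ) * v) + σ * B * (Σ * u) ≡ (σ * Σ) * (σ * L * v + B * u)
      odd-identity = solve-∀
      power : + (σ ^ suc k) ≡ + σ * Σ
      power = pos-* σ (σ ^ k)
      even : S (double (suc k)) ≡ + (σ ^ suc k) * V (suc k)
      even = begin
        p * S (suc (double k)) + q * S (double k)
          ≡⟨ cong₂ (λ x y → p * x + q * y) (proj₂ (cofactors k)) (proj₁ (cofactors k)) ⟩
        p * (Σ * U k) + q * (Σ * V k)
          ≡⟨ even-identity (+ σ) L B Σ (U k) (V k) ⟩
        (+ σ * Σ) * V (suc k)
          ≡⟨ cong (_* V (suc k)) (sym power) ⟩
        + (σ ^ suc k) * V (suc k)  ∎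
        where open ≡-Reasoning
      odd : S (suc (double (suc k))) ≡ + (σ ^ suc k) * U (suc k)
      odd = begin
        p * S (double (suc k)) + q * S (suc (double k))
          ≡⟨ cong₂ (λ x y → p * x + q * y) (trans even (cong (_* V (suc k)) power)) (proj₂ (cofactors k)) ⟩
        p * ((+ σ * Σ) * V (suc k)) + q * (Σ * U k)
          ≡⟨ odd-identity (+ σ) L B Σ (U k) (V (suc k)) ⟩
        (+ σ * Σ) * U (suc k)
          ≡⟨ cong (_* U (suc k)) (sym power) ⟩
        + (σ ^ suc k) * U (suc k)  ∎
        where open ≡-Reasoning

    -- Modulo σ, U (k+1) ≡ B U k.
    U-coprime-σ : Coprime B (+ σ) → ∀ k → Coprime (U k) (+ σ)
    U-coprime-σ B⊥σ zero = 1-coprimeTo σ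
    U-coprime-σ B⊥σ (suc k) =
      subst (λ x → Coprime x (+ σ)) (sym (regroup (+ σ) L B (U k) (V (suc k))))
        (coprime-+-multiple (B * U k) (+ σ) (L * V (suc k))
          (coprime-*ˡ B (U k) (+ σ) B⊥σ (U-coprime-σ B⊥σ k)))
      where
      regroup : ∀ σ L B u v → σ * L * v + B * u ≡ B * u + σ * (L * v)
      regroup = solve-∀

    -- Modulo B, U (k+1) ≡ σ L² U k.
    U-coprime-B : Coprime p B → ∀ k → Coprime (U k) B
    U-coprime-B p⊥B zero = 1-coprimeTo ∣ B ∣
    U-coprime-B p⊥B (suc k) =
      subst (λ x → Coprime x B) (sym (regroup p L B (U k) (V k)))
        (coprime-+-multiple (p * L * U k) B (p * V k + U k)
          (coprime-*ˡ (p * L) (U k) B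
            (coprime-*ˡ p L B p⊥B (factor-coprimeʳ (+ σ) L B p⊥B)) (U-coprime-B p⊥B k)))
      where
      regroup : ∀ p L B u v → p * (L * u + B * v) + B * u ≡ p * L * u + B * (p * v + u)
      regroup = solve-∀

    U-coprime : Coprime p B → ∀ k → Coprime (U k) q
    U-coprime p⊥B k =
      coprime-*ʳ (U k) (+ σ) B
        (U-coprime-σ (ℕᶜ.sym (factor-coprimeˡ (+ σ) L B p⊥B)) k) (U-coprime-B p⊥B k)

    -- The gcd at n + 1
    -- divides both q σ^⌊(n+1)/2⌋ (recurrence and induction) and
    -- σ^⌊(n+1)/2⌋ U_⌊(n+1)/2⌋ (an odd-indexed term), and U is coprime to q.
    G-bound : Coprime p B → ∀ n → G p q n ℕᵈ.∣ σ ^ ⌊ n /2⌋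
    G-bound p⊥B zero = gcd[m,n]∣m 1 0
    G-bound p⊥B (suc n) = coprime-factors (U-coprime p⊥B k) (d∣Uσᵏ , d∣qσᵏ)
      where
      k : ℕ
      k = ⌊ suc n /2⌋
      odd-term : ∣ S (suc (double k)) ∣ ≡ ∣ U k ∣ ℕ.* σ ^ k
      odd-term = trans (cong ∣_∣ (proj₂ (cofactors k)))
                       (trans (abs-* (+ (σ ^ k)) (U k)) (*-comm (σ ^ k) ∣ U k ∣))
      d∣Uσᵏ : G p q (suc n) ℕᵈ.∣ ∣ U k ∣ ℕ.* σ ^ k
      d∣Uσᵏ = subst (G p q (suc n) ℕᵈ.∣_) odd-term (gcd-consecutive-∣-odd (λ j → ∣ S j ∣) (suc n))
      d∣qσᵏ : G p q (suc n) ℕᵈ.∣ ∣ q ∣ ℕ.* σ ^ k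
      d∣qσᵏ = ∣-trans (G-step p q n)
                (*-monoʳ-∣ ∣ q ∣ (∣-trans (G-bound p⊥B n) (^-monoʳ-∣ σ (⌊n/2⌋-mono (n≤1+n n)))))

open import Data.Nat.Base using (ℕ; zero; suc; _≥_; _^_; _/_; ⌊_/2⌋; NonZero; s≤s) renaming (_*_ to _*ℕ_)
open import Data.Nat.GCD using (gcd)
import Data.Nat.Divisibility as ℕᵈ
open import Data.Nat.Coprimality using () renaming (Coprime to Coprimeℕ)
open import Data.Integer.Base using (ℤ; +_; _+_; _*_; _>_; _≤_; ∣_∣; +<+; sign; _◃_)
import Data.Integer.Properties as ℤP
open import Data.Integer.GCD using () renaming (gcd to gcdℤ)
open import Data.Integer.Divisibility using (_∣_)
open import Data.Integer.Coprimality using (Coprime)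
import Data.Sign as Sign
open import Data.Product using (_,_; ∃₂; _×_)
open import Relation.Binary.PropositionalEquality
  using (_≡_; _≢_; refl; sym; trans; cong; cong₂; subst; subst₂)
open NatFacts using (factorisation; gcd-scaled-∣; ⌊n/2⌋≡n/2)
open LucasSequence using (s-scale; module Cofactors)

record Factorisation (ℓ b : ℤ) (t σ : ℕ) : Set where
  field
    L B : ℤ
    ℓ≡ : ℓ ≡ + t * (+ σ * L)
    b≡ : b ≡ + t * (+ t * (+ σ * B))
    coprime : Coprime (+ σ * L) B

◃-pull : ∀ sg m n → sg ◃ (m *ℕ n) ≡ + m * (sg ◃ n)
◃-pull sg m n = trans (ℤP.◃-distrib-* Sign.+ sg m n) (cong (_* (sg ◃ n)) (ℤP.+◃n≡+n m))

signed-factor : ∀ x m n → ∣ x ∣ ≡ m *ℕ n → x ≡ + m * (sign x ◃ n)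
signed-factor x m n ∣x∣≡mn =
  trans (sym (ℤP.◃-inverse x)) (trans (cong (sign x ◃_) ∣x∣≡mn) (◃-pull (sign x) m n))

lift-factorisation : ∀ ℓ b t σ →
  ∃₂ (λ L B → ∣ ℓ ∣ ≡ t *ℕ (σ *ℕ L) × ∣ b ∣ ≡ t *ℕ (t *ℕ (σ *ℕ B)) × Coprimeℕ (σ *ℕ L) B) →
  Factorisation ℓ b t σ
lift-factorisation ℓ b t σ (L , B , ∣ℓ∣≡ , ∣b∣≡ , σL⊥B) = record
  { L = sign ℓ ◃ L
  ; B = sign b ◃ B
  ; ℓ≡ = trans (signed-factor ℓ t (σ *ℕ L) ∣ℓ∣≡) (cong (+ t *_) (◃-pull (sign ℓ) σ L))
  ; b≡ = trans (signed-factor b t (t *ℕ (σ *ℕ B)) ∣b∣≡)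
           (cong (+ t *_) (trans (◃-pull (sign b) t (σ *ℕ B)) (cong (+ t *_) (◃-pull (sign b) σ B))))
  ; coprime = subst₂ Coprimeℕ
                (sym (trans (ℤP.abs-* (+ σ) (sign ℓ ◃ L)) (cong (σ *ℕ_) (ℤP.abs-◃ (sign ℓ) L))))
                (sym (ℤP.abs-◃ (sign b) B)) σL⊥B
  }

integer-factorisation : ∀ ℓ b → .{{NonZero ∣ ℓ ∣}} →
  let r = gcd ∣ ℓ ∣ ∣ b ∣
      t = gcd ((∣ ℓ ∣ ^ 2) ÷ r) (∣ b ∣ ÷ r)
  in Factorisation ℓ b t (r ÷ t)
integer-factorisation ℓ b = lift-factorisation ℓ b t (r ÷ t) (factorisation ∣ ℓ ∣ ∣ b ∣)
  where
  r t : ℕ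
  r = gcd ∣ ℓ ∣ ∣ b ∣
  t = gcd ((∣ ℓ ∣ ^ 2) ÷ r) (∣ b ∣ ÷ r)

factorised-bound : ∀ {ℓ b t σ} → Factorisation ℓ b t σ → ∀ m →
  gcd (∣ s ℓ b (suc (suc m)) ∣) (∣ s ℓ b (suc m) ∣) ℕᵈ.∣ t ^ suc m *ℕ σ ^ ⌊ suc m /2⌋
factorised-bound {t = t} {σ} record { L = L ; B = B ; ℓ≡ = refl ; b≡ = refl ; coprime = σL⊥B } m = begin
  gcd (∣ s (+ t * p) (+ t * (+ t * q)) (suc (suc m)) ∣) (∣ s (+ t * p) (+ t * (+ t * q)) (suc m) ∣)
    ≡⟨ cong₂ gcd (scaled (suc m)) (scaled m) ⟩
  gcd (t ^ suc m *ℕ ∣ S (suc (suc m)) ∣) (t ^ m *ℕ ∣ S (suc m) ∣)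
    ∣⟨ gcd-scaled-∣ (t ^ suc m) (t ^ m) _ _ (ℕᵈ.∣n⇒∣m*n t ℕᵈ.∣-refl) ⟩
  t ^ suc m *ℕ gcd (∣ S (suc (suc m)) ∣) (∣ S (suc m) ∣)
    ∣⟨ ℕᵈ.*-monoʳ-∣ (t ^ suc m) (G-bound σL⊥B (suc m)) ⟩
  t ^ suc m *ℕ σ ^ ⌊ suc m /2⌋  ∎
  where
  open ℕᵈ.∣-Reasoning
  open Cofactors σ L B
  scaled : ∀ n → ∣ s (+ t * p) (+ t * (+ t * q)) (suc n) ∣ ≡ t ^ n *ℕ ∣ S (suc n) ∣
  scaled n = trans (cong ∣_∣ (s-scale t p q n)) (ℤP.abs-* (+ (t ^ n)) (S (suc n)))

positive-abs : ∀ {ℓ} → ℓ > + 0 → NonZero ∣ ℓ ∣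
positive-abs (+<+ (s≤s _)) = _

lemma3p9 : (ℓ b : ℤ) → ℓ > + 0 → b ≢ + 0 → + 0 ≤ ℓ * ℓ + + 4 * b →
    let r = gcd ∣ ℓ ∣ ∣ b ∣
        t = gcd ((∣ ℓ ∣ ^ 2) ÷ r) (∣ b ∣ ÷ r)
        σ = r ÷ t
    in (n : ℕ) → n ≥ 1 →
       gcdℤ (s ℓ b (suc n)) (s ℓ b n) ∣ + (t ^ n *ℕ σ ^ (n / 2))
lemma3p9 ℓ b ℓ>0 _ _ zero ()
lemma3p9 ℓ b ℓ>0 _ _ (suc m) _ =
  subst (λ e → gcd (∣ s ℓ b (suc (suc m)) ∣) (∣ s ℓ b (suc m) ∣) ℕᵈ.∣ t ^ suc m *ℕ σ ^ e)
        (⌊n/2⌋≡n/2 (suc m))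
        (factorised-bound (integer-factorisation ℓ b {{positive-abs ℓ>0}}) m)
  where
  r t σ : ℕ
  r = gcd ∣ ℓ ∣ ∣ b ∣
  t = gcd ((∣ ℓ ∣ ^ 2) ÷ r) (∣ b ∣ ÷ r)
  σ = r ÷ t
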